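{- Let $n\geq 1$ and let $H,G\leq W_n$ be non-cyclic subgroups such that $H\cap K_n=\{\mathrm{id}\}$, $|H|=|G|$, and $H$ is elementwise $K_n$-conjugate into $G$. Let $H_1,H_2$ be two distinct maximal subgroups of $H$, and suppose that $G=\langle H_1,H_2^a\rangle$ for some $a\in K_n$. Then $a\in C_{K_n}(\Phi(H))$.
   Context: $T_n$ is the complete binary rooted tree with $n$ levels and $W_n=\mathrm{Aut}(T_n)$. Restriction to the first $n-1$ levels gives a surjection $\pi_n:W_n\to W_{n-1}$, and $K_n=\ker(\pi_n)$ (an elementary abelian $2$-group). For $x,a\in W_n$, $x^a=a^{ -1}xa$, and $S^a=a^{ -1}Sa$ for a subgroup $S$. $H$ is elementwise $K_n$-conjugate into $G$ if for every $h\in H$ there exists $c\in K_n$ with $h^c\in G$. $\Phi(H)$ is the Frattini subgroup of $H$ (intersection of all maximal subgroups), and $C_{K_n}(S)$ is the set of elements of $K_n$ commuting with every element of $S$. -}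

module Defs where

open import Data.Nat using (ℕ; zero; suc)
open import Data.Bool using (Bool; true; false; not; _xor_)
open import Data.Unit using (⊤; tt)
open import Data.Product using (Σ; ∃; _×_; _,_)
open import Data.Sum using (_⊎_)
open import Data.Vec using (Vec; []; _∷_)
open import Relation.Binary.PropositionalEquality using (_≡_)
open import Relation.Nullary using (¬_)
open import Function.Bundles using (_↔_)

-- W_n = Aut(T_n), T_n the complete binary rooted tree with n levels
-- below the root (leaves = binary words of length n).  An automorphism
-- is given by its portrait: a bit at the root (swap or not) together
-- with the automorphisms induced on the left and right subtrees.
-- This representation is unique, so ≡ is equality in W_n.

Aut : ℕ → Set
Aut zero    = ⊤
Aut (suc n) = Bool × Aut n × Aut n

-- action on the leaves (documentation of the convention)
act : ∀ {n} → Aut n → Vec Bool n → Vec Bool n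
act {zero}  _ [] = []
act {suc n} (b , l , r) (false ∷ xs) = b ∷ act l xs
act {suc n} (b , l , r) (true  ∷ xs) = not b ∷ act r xs

e : ∀ {n} → Aut n
e {zero}  = tt
e {suc n} = false , e , e

-- product: (f · g) acts as "first g, then f", i.e. act (f · g) = act f ∘ act g
infixl 7 _·_
_·_ : ∀ {n} → Aut n → Aut n → Aut n
_·_ {zero}  _ _ = tt
_·_ {suc n} (b₁ , l₁ , r₁) (false , l₂ , r₂) = b₁ , l₁ · l₂ , r₁ · r₂
_·_ {suc n} (b₁ , l₁ , r₁) (true  , l₂ , r₂) = not b₁ , r₁ · l₂ , l₁ · r₂

_⁻¹ : ∀ {n} → Aut n → Aut n
_⁻¹ {zero}  _ = tt
_⁻¹ {suc n} (false , l , r) = false , l ⁻¹ , r ⁻¹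
_⁻¹ {suc n} (true  , l , r) = true  , r ⁻¹ , l ⁻¹

_^_ : ∀ {n} → Aut n → ℕ → Aut n
g ^ zero  = e
g ^ suc k = g · (g ^ k)

conj : ∀ {n} → Aut n → Aut n → Aut n
conj x a = (a ⁻¹) · x · a

-- restriction π : W_{n+1} → W_n to the first n levels, and K_{n+1} = ker π

restrict : ∀ n → Aut (suc n) → Aut n
restrict zero    _ = tt
restrict (suc n) (b , l , r) = b , restrict n l , restrict n r

InK : ∀ n → Aut (suc n) → Set
InK n g = restrict n g ≡ e

Subset : ℕ → Set
Subset n = Aut n → Bool

_∈_ : ∀ {n} → Aut n → Subset n → Set
x ∈ S = S x ≡ true

_⊆_ : ∀ {n} → Subset n → Subset n → Set
S ⊆ T = ∀ x → x ∈ S → x ∈ T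

_≐_ : ∀ {n} → Subset n → Subset n → Set
S ≐ T = ∀ x → S x ≡ T x

record IsSubgroup {n} (S : Subset n) : Set where
  field
    has-e   : e ∈ S
    has-·   : ∀ x y → x ∈ S → y ∈ S → (x · y) ∈ S
    has-⁻¹  : ∀ x → x ∈ S → (x ⁻¹) ∈ S

El : ∀ {n} → Subset n → Set
El {n} S = Σ (Aut n) (λ x → x ∈ S)

SameOrder : ∀ {n} → Subset n → Subset n → Set
SameOrder S T = El S ↔ El T

IsCyclic : ∀ {n} → Subset n → Set
IsCyclic {n} S = Σ (Aut n) λ g → g ∈ S × (∀ x → x ∈ S → ∃ λ k → x ≡ g ^ k)

IsMaximal : ∀ {n} → Subset n → Subset n → Set
IsMaximal {n} M H =
  IsSubgroup M × M ⊆ H × ¬ (M ≐ H) ×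
  (∀ (L : Subset n) → IsSubgroup L → M ⊆ L → L ⊆ H → (L ≐ M) ⊎ (L ≐ H))

InFrattini : ∀ {n} → Subset n → Aut n → Set
InFrattini {n} H x = ∀ (M : Subset n) → IsMaximal M H → x ∈ M

-- conjugate subset S^a = { a⁻¹ s a : s ∈ S }
_^ˢ_ : ∀ {n} → Subset n → Aut n → Subset n
(S ^ˢ a) x = S (a · x · (a ⁻¹))

data Gen {n} (S : Aut n → Set) : Aut n → Set where
  gen  : ∀ {x} → S x → Gen S x
  unit : Gen S e
  mul  : ∀ {x y} → Gen S x → Gen S y → Gen S (x · y)
  inv  : ∀ {x} → Gen S x → Gen S (x ⁻¹)

IsGeneratedBy : ∀ {n} → Subset n → (Aut n → Set) → Set
IsGeneratedBy {n} G S = ∀ x → (x ∈ G → Gen S x) × (Gen S x → x ∈ G)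

_∪_ : ∀ {n} → Subset n → Subset n → Aut n → Set
(S ∪ T) x = x ∈ S ⊎ x ∈ T

-- Since a ∈ K_n, restriction π to the first n − 1 levels cannot tell h from h^a.  The elements
-- h ∈ H with π h ∈ π(G) form a subgroup containing H₁ and H₂ (as h^a ∈ H₂^a ⊆ G), hence all of H,
-- for two distinct maximal subgroups generate H.  As H ∩ K_n = 1, π is injective on H, and the
-- induced injection H → G is a bijection because |H| = |G|; so π is injective on G as well.
-- Each x ∈ Φ(H) has x ∈ H₁ ⊆ G and x^a ∈ H₂^a ⊆ G with π x = π (x^a), whence x^a = x.
module Submission where

open import Defs
open import Algebra.Bundles using (Group)
import Algebra.Properties.Group
open import Algebra.Structures using (IsGroup)
open import Axiom.UniquenessOfIdentityProofs using (module Decidable⇒UIP)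
open import Data.Bool using (Bool; true; false; not; _∧_)
import Data.Bool.Properties as Bool
open import Data.Empty using (⊥-elim)
open import Data.Fin using (Fin; punchOut)
open import Data.Fin.Properties
  using (any?; _≟_; pigeonhole; punchOut-injective; <-irrefl; 1↔⊤; 2↔Bool; *↔×)
open import Data.Nat using (ℕ; zero; suc; _*_)
open import Data.Nat.Properties using (n<1+n)
open import Data.Product using (Σ; ∃; _×_; _,_; proj₁; proj₂)
open import Data.Product.Function.NonDependent.Propositional using (_×-↔_)
open import Data.Product.Properties using (≡-dec)
open import Data.Sum using (inj₁; inj₂)
open import Data.Unit using (tt)
open import Function using (_∘_)
open import Function.Bundles using (_↔_; Inverse; Injection; mk⇔)
open import Function.Properties.Inverse using (↔-sym; ↔-trans; ↔-refl; ↔⇒↣)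
open import Level using (0ℓ)
open import Relation.Binary.Definitions using (DecidableEquality)
open import Relation.Binary.PropositionalEquality
open import Relation.Nullary using (¬_; Dec; yes; no; does; _×-dec_)
import Relation.Nullary.Decidable as Dec
open import Relation.Unary using (Decidable)

·-assoc : ∀ {n} (x y z : Aut n) → x · y · z ≡ x · (y · z)
·-assoc {zero}  _ _ _ = refl
·-assoc {suc n} (b , lx , rx) (false , ly , ry) (false , lz , rz) =
  cong₂ (λ u v → b , u , v) (·-assoc lx ly lz) (·-assoc rx ry rz)
·-assoc {suc n} (b , lx , rx) (false , ly , ry) (true , lz , rz) =
  cong₂ (λ u v → not b , u , v) (·-assoc rx ry lz) (·-assoc lx ly rz)
·-assoc {suc n} (b , lx , rx) (true , ly , ry) (false , lz , rz) =
  cong₂ (λ u v → not b , u , v) (·-assoc rx ly lz) (·-assoc lx ry rz)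
·-assoc {suc n} (false , lx , rx) (true , ly , ry) (true , lz , rz) =
  cong₂ (λ u v → false , u , v) (·-assoc lx ry lz) (·-assoc rx ly rz)
·-assoc {suc n} (true , lx , rx) (true , ly , ry) (true , lz , rz) =
  cong₂ (λ u v → true , u , v) (·-assoc lx ry lz) (·-assoc rx ly rz)

·-identityˡ : ∀ {n} (x : Aut n) → e · x ≡ x
·-identityˡ {zero}  _ = refl
·-identityˡ {suc n} (false , l , r) = cong₂ (λ u v → false , u , v) (·-identityˡ l) (·-identityˡ r)
·-identityˡ {suc n} (true  , l , r) = cong₂ (λ u v → true , u , v) (·-identityˡ l) (·-identityˡ r)

·-identityʳ : ∀ {n} (x : Aut n) → x · e ≡ x
·-identityʳ {zero}  _ = refl
·-identityʳ {suc n} (b , l , r) = cong₂ (λ u v → b , u , v) (·-identityʳ l) (·-identityʳ r)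

·-inverseˡ : ∀ {n} (x : Aut n) → x ⁻¹ · x ≡ e
·-inverseˡ {zero}  _ = refl
·-inverseˡ {suc n} (false , l , r) = cong₂ (λ u v → false , u , v) (·-inverseˡ l) (·-inverseˡ r)
·-inverseˡ {suc n} (true  , l , r) = cong₂ (λ u v → false , u , v) (·-inverseˡ l) (·-inverseˡ r)

·-inverseʳ : ∀ {n} (x : Aut n) → x · x ⁻¹ ≡ e
·-inverseʳ {zero}  _ = refl
·-inverseʳ {suc n} (false , l , r) = cong₂ (λ u v → false , u , v) (·-inverseʳ l) (·-inverseʳ r)
·-inverseʳ {suc n} (true  , l , r) = cong₂ (λ u v → false , u , v) (·-inverseʳ r) (·-inverseʳ l)

Aut-isGroup : ∀ n → IsGroup _≡_ (_·_ {n}) e _⁻¹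
Aut-isGroup n = record
  { isMonoid = record
    { isSemigroup = record
      { isMagma = record { isEquivalence = isEquivalence ; ∙-cong = cong₂ _·_ }
      ; assoc   = ·-assoc
      }
    ; identity = ·-identityˡ , ·-identityʳ
    }
  ; inverse = ·-inverseˡ , ·-inverseʳ
  ; ⁻¹-cong = cong _⁻¹
  }

Aut-group : ℕ → Group 0ℓ 0ℓ
Aut-group n = record { isGroup = Aut-isGroup n }

module AutGroupProperties {n : ℕ} = Algebra.Properties.Group (Aut-group n)
open AutGroupProperties using (ε⁻¹≈ε; x∙y⁻¹≈ε⇒x≈y)

conj-cancel : ∀ {n} (x a : Aut n) → a · conj x a · a ⁻¹ ≡ x
conj-cancel x a = begin
  a · (a ⁻¹ · x · a) · a ⁻¹   ≡⟨ cong (_· a ⁻¹) (sym (·-assoc a (a ⁻¹ · x) a)) ⟩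
  a · (a ⁻¹ · x) · a · a ⁻¹   ≡⟨ ·-assoc (a · (a ⁻¹ · x)) a (a ⁻¹) ⟩
  a · (a ⁻¹ · x) · (a · a ⁻¹) ≡⟨ cong₂ _·_ (sym (·-assoc a (a ⁻¹) x)) (·-inverseʳ a) ⟩
  a · a ⁻¹ · x · e            ≡⟨ ·-identityʳ _ ⟩
  a · a ⁻¹ · x                ≡⟨ cong (_· x) (·-inverseʳ a) ⟩
  e · x                       ≡⟨ ·-identityˡ x ⟩
  x                           ∎
  where open ≡-Reasoning

conj-fixed⇒commute : ∀ {n} (x a : Aut n) → conj x a ≡ x → a · x ≡ x · a
conj-fixed⇒commute x a xᵃ≡x = begin
  a · x                     ≡⟨ cong (a ·_) (sym xᵃ≡x) ⟩
  a · (a ⁻¹ · x · a)        ≡⟨ sym (·-assoc a (a ⁻¹ · x) a) ⟩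
  a · (a ⁻¹ · x) · a        ≡⟨ cong (_· a) (sym (·-assoc a (a ⁻¹) x)) ⟩
  a · a ⁻¹ · x · a          ≡⟨ cong (λ u → u · x · a) (·-inverseʳ a) ⟩
  e · x · a                 ≡⟨ cong (_· a) (·-identityˡ x) ⟩
  x · a                     ∎
  where open ≡-Reasoning

restrict-· : ∀ n (x y : Aut (suc n)) → restrict n (x · y) ≡ restrict n x · restrict n y
restrict-· zero    _ _ = refl
restrict-· (suc n) (b , lx , rx) (false , ly , ry) =
  cong₂ (λ u v → b , u , v) (restrict-· n lx ly) (restrict-· n rx ry)
restrict-· (suc n) (b , lx , rx) (true , ly , ry) =
  cong₂ (λ u v → not b , u , v) (restrict-· n rx ly) (restrict-· n lx ry)

restrict-⁻¹ : ∀ n (x : Aut (suc n)) → restrict n (x ⁻¹) ≡ restrict n x ⁻¹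
restrict-⁻¹ zero    _ = refl
restrict-⁻¹ (suc n) (false , l , r) = cong₂ (λ u v → false , u , v) (restrict-⁻¹ n l) (restrict-⁻¹ n r)
restrict-⁻¹ (suc n) (true  , l , r) = cong₂ (λ u v → true , u , v) (restrict-⁻¹ n r) (restrict-⁻¹ n l)

restrict-conj : ∀ n {a} (x : Aut (suc n)) → InK n a → restrict n (conj x a) ≡ restrict n x
restrict-conj n {a} x a∈K = begin
  restrict n (a ⁻¹ · x · a)             ≡⟨ restrict-· n (a ⁻¹ · x) a ⟩
  restrict n (a ⁻¹ · x) · restrict n a  ≡⟨ cong₂ _·_ (restrict-· n (a ⁻¹) x) a∈K ⟩
  restrict n (a ⁻¹) · restrict n x · e  ≡⟨ ·-identityʳ _ ⟩
  restrict n (a ⁻¹) · restrict n x      ≡⟨ cong (_· restrict n x) πa⁻¹≡e ⟩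
  e · restrict n x                      ≡⟨ ·-identityˡ _ ⟩
  restrict n x                          ∎
  where
  open ≡-Reasoning
  πa⁻¹≡e : restrict n (a ⁻¹) ≡ e
  πa⁻¹≡e = trans (restrict-⁻¹ n a) (trans (cong _⁻¹ a∈K) ε⁻¹≈ε)

InjectiveOn : ∀ {n} {B : Set} → (Aut n → B) → Subset n → Set
InjectiveOn φ S = ∀ x y → x ∈ S → y ∈ S → φ x ≡ φ y → x ≡ y

trivial-kernel⇒injectiveOn : ∀ n {H : Subset (suc n)} → IsSubgroup H →
  (∀ x → x ∈ H → InK n x → x ≡ e) → InjectiveOn (restrict n) H
trivial-kernel⇒injectiveOn n {H} H-subgroup H∩K≡e x y x∈H y∈H πx≡πy =
  x∙y⁻¹≈ε⇒x≈y x y (H∩K≡e (x · y ⁻¹) xy⁻¹∈H (begin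
    restrict n (x · y ⁻¹)            ≡⟨ restrict-· n x (y ⁻¹) ⟩
    restrict n x · restrict n (y ⁻¹) ≡⟨ cong₂ _·_ πx≡πy (restrict-⁻¹ n y) ⟩
    restrict n y · restrict n y ⁻¹   ≡⟨ ·-inverseʳ _ ⟩
    e                                ∎))
  where
  open ≡-Reasoning
  open IsSubgroup H-subgroup
  xy⁻¹∈H : (x · y ⁻¹) ∈ H
  xy⁻¹∈H = has-· x (y ⁻¹) x∈H (has-⁻¹ y y∈H)

DedekindFinite : Set → Set
DedekindFinite A = (f : A → A) → (∀ x y → f x ≡ f y → x ≡ y) → ∀ y → ∃ λ x → f x ≡ y

Fin-dedekindFinite : ∀ N → DedekindFinite (Fin N)
Fin-dedekindFinite N f f-inj y with any? (λ i → f i ≟ y)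
... | yes hit = hit
Fin-dedekindFinite (suc N) f f-inj y | no miss =
  let i , j , i<j , fᵢ≡fⱼ = pigeonhole (n<1+n N) (λ i → punchOut (y≢f i))
  in ⊥-elim (<-irrefl (f-inj i j (punchOut-injective (y≢f i) (y≢f j) fᵢ≡fⱼ)) i<j)
  where
  y≢f : ∀ i → y ≢ f i
  y≢f i y≡fᵢ = miss (i , sym y≡fᵢ)

↔-injectiveˡ : ∀ {A B : Set} (A↔B : A ↔ B) {x y : A} → Inverse.to A↔B x ≡ Inverse.to A↔B y → x ≡ y
↔-injectiveˡ A↔B = Injection.injective (↔⇒↣ A↔B)

↔-injectiveʳ : ∀ {A B : Set} (A↔B : A ↔ B) {x y : B} → Inverse.from A↔B x ≡ Inverse.from A↔B y → x ≡ y
↔-injectiveʳ A↔B = ↔-injectiveˡ (↔-sym A↔B)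

injective⇒surjective : ∀ {A B : Set} → A ↔ B → DedekindFinite A →
  (f : A → B) → (∀ x y → f x ≡ f y → x ≡ y) → ∀ y → ∃ λ x → f x ≡ y
injective⇒surjective A↔B A-finite f f-inj y =
  let x , from∘f[x]≡from[y] = A-finite (λ x → from (f x))
        (λ x x′ eq → f-inj x x′ (↔-injectiveʳ A↔B eq)) (from y)
  in x , ↔-injectiveʳ A↔B from∘f[x]≡from[y]
  where open Inverse A↔B

↔-dedekindFinite : ∀ {A B : Set} → A ↔ B → DedekindFinite A → DedekindFinite B
↔-dedekindFinite A↔B A-finite f f-inj y =
  let x , f[to[x]]≡y = injective⇒surjective A↔B A-finite (f ∘ to)
        (λ x x′ eq → ↔-injectiveˡ A↔B (f-inj _ _ eq)) y
  in to x , f[to[x]]≡y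
  where open Inverse A↔B

∣Aut∣ : ℕ → ℕ
∣Aut∣ zero    = 1
∣Aut∣ (suc n) = 2 * (∣Aut∣ n * ∣Aut∣ n)

Aut↔Fin : ∀ n → Aut n ↔ Fin (∣Aut∣ n)
Aut↔Fin zero    = ↔-sym 1↔⊤
Aut↔Fin (suc n) =
  ↔-trans (↔-sym 2↔Bool ×-↔ (Aut↔Fin n ×-↔ Aut↔Fin n))
  (↔-trans (↔-refl ×-↔ ↔-sym (*↔× {∣Aut∣ n} {∣Aut∣ n})) (↔-sym (*↔× {2} {∣Aut∣ n * ∣Aut∣ n})))

Aut-dedekindFinite : ∀ n → DedekindFinite (Aut n)
Aut-dedekindFinite n = ↔-dedekindFinite (↔-sym (Aut↔Fin n)) (Fin-dedekindFinite _)

Aut-∃? : ∀ {n} {P : Aut n → Set} → Decidable P → Dec (∃ P)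
Aut-∃? {n} {P} P? = Dec.map (mk⇔ (λ (i , p) → from i , p) (λ (x , p) → to x , subst P (sym (strictlyInverseʳ x)) p))
  (any? (λ i → P? (from i)))
  where open Inverse (Aut↔Fin n)

_≟ᴬ_ : ∀ {n} → DecidableEquality (Aut n)
_≟ᴬ_ {zero}  tt tt = yes refl
_≟ᴬ_ {suc n} = ≡-dec Bool._≟_ (≡-dec _≟ᴬ_ _≟ᴬ_)

module _ {A : Set} (S : A → Bool) where

  subtype-≡ : ∀ {x y} (p : S x ≡ true) (q : S y ≡ true) → x ≡ y → _≡_ {A = Σ A λ x → S x ≡ true} (x , p) (y , q)
  subtype-≡ p q refl = cong (_ ,_) (Decidable⇒UIP.≡-irrelevant Bool._≟_ p q)

  -- Extend f by the identity outside S; the extension is injective, hence onto.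
  subtype-dedekindFinite : DedekindFinite A → DedekindFinite (Σ A λ x → S x ≡ true)
  subtype-dedekindFinite A-finite f f-inj (y , y∈S) =
    let x , f̂x≡y = A-finite f̂ f̂-inj y in preimage x (S x) refl f̂x≡y
    where
    excluded : ∀ {z} → S z ≡ true → ¬ S z ≡ false
    excluded z∈S z∉S with () ← trans (sym z∈S) z∉S

    extend : ∀ x b → S x ≡ b → A
    extend x true  x∈S = proj₁ (f (x , x∈S))
    extend x false _   = x

    f̂ : A → A
    f̂ x = extend x (S x) refl

    extend-inj : ∀ x x′ b b′ (p : S x ≡ b) (p′ : S x′ ≡ b′) → extend x b p ≡ extend x′ b′ p′ → x ≡ x′
    extend-inj x x′ true true p p′ eq =
      cong proj₁ (f-inj (x , p) (x′ , p′) (subtype-≡ (proj₂ (f (x , p))) (proj₂ (f (x′ , p′))) eq))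
    extend-inj x x′ true false p p′ eq = ⊥-elim (excluded (subst (λ u → S u ≡ true) eq (proj₂ (f (x , p)))) p′)
    extend-inj x x′ false true p p′ eq = ⊥-elim (excluded (subst (λ u → S u ≡ true) (sym eq) (proj₂ (f (x′ , p′)))) p)
    extend-inj x x′ false false p p′ eq = eq

    f̂-inj : ∀ x x′ → f̂ x ≡ f̂ x′ → x ≡ x′
    f̂-inj x x′ = extend-inj x x′ (S x) (S x′) refl refl

    preimage : ∀ x b (p : S x ≡ b) → extend x b p ≡ y → ∃ λ x̃ → f x̃ ≡ (y , y∈S)
    preimage x true  x∈S eq = (x , x∈S) , subtype-≡ (proj₂ (f (x , x∈S))) y∈S eq
    preimage x false x∉S refl = ⊥-elim (excluded y∈S x∉S)

_∩_ : ∀ {n} → Subset n → Subset n → Subset n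
(S ∩ T) x = S x ∧ T x

∩-intro : ∀ {n} (S T : Subset n) {x} → x ∈ S → x ∈ T → x ∈ (S ∩ T)
∩-intro S T x∈S x∈T rewrite x∈S = x∈T

∩-⊆ˡ : ∀ {n} (S T : Subset n) → (S ∩ T) ⊆ S
∩-⊆ˡ S T x x∈S∩T with S x
... | true = refl

∩-⊆ʳ : ∀ {n} (S T : Subset n) → (S ∩ T) ⊆ T
∩-⊆ʳ S T x x∈S∩T with S x
... | true = x∈S∩T

∩-isSubgroup : ∀ {n} {S T : Subset n} → IsSubgroup S → IsSubgroup T → IsSubgroup (S ∩ T)
∩-isSubgroup {S = S} {T} S≤ T≤ = record
  { has-e  = ∩-intro S T S.has-e T.has-e
  ; has-·  = λ x y x∈ y∈ → ∩-intro S T (S.has-· x y (inS x x∈) (inS y y∈)) (T.has-· x y (inT x x∈) (inT y y∈))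
  ; has-⁻¹ = λ x x∈ → ∩-intro S T (S.has-⁻¹ x (inS x x∈)) (T.has-⁻¹ x (inT x x∈))
  }
  where
  module S = IsSubgroup S≤
  module T = IsSubgroup T≤
  inS : (S ∩ T) ⊆ S
  inS = ∩-⊆ˡ S T
  inT : (S ∩ T) ⊆ T
  inT = ∩-⊆ʳ S T

distinct-maximal-⊆ : ∀ {n} {H H₁ H₂ L : Subset n} → IsSubgroup H →
  IsMaximal H₁ H → IsMaximal H₂ H → ¬ (H₁ ≐ H₂) → IsSubgroup L → H₁ ⊆ L → H₂ ⊆ L → H ⊆ L
distinct-maximal-⊆ {H = H} {H₁} {H₂} {L} H≤ (H₁≤ , H₁⊆H , H₁≉H , H₁-max) (_ , H₂⊆H , _ , H₂-max)
                   H₁≉H₂ L≤ H₁⊆L H₂⊆L x x∈H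
  with H₁-max (H ∩ L) H∩L≤ (λ y y∈H₁ → ∩-intro H L (H₁⊆H y y∈H₁) (H₁⊆L y y∈H₁)) (∩-⊆ˡ H L)
  where
  H∩L≤ : IsSubgroup (H ∩ L)
  H∩L≤ = ∩-isSubgroup H≤ L≤
... | inj₂ H∩L≐H = ∩-⊆ʳ H L x (trans (H∩L≐H x) x∈H)
... | inj₁ H∩L≐H₁ with H₂-max H₁ H₁≤ H₂⊆H₁ H₁⊆H
  where
  H₂⊆H₁ : H₂ ⊆ H₁
  H₂⊆H₁ y y∈H₂ = trans (sym (H∩L≐H₁ y)) (∩-intro H L (H₂⊆H y y∈H₂) (H₂⊆L y y∈H₂))
...   | inj₁ H₁≐H₂ = ⊥-elim (H₁≉H₂ H₁≐H₂)
...   | inj₂ H₁≐H  = ⊥-elim (H₁≉H H₁≐H)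

InImage : ∀ {n} {B : Set} → (Aut n → B) → Subset n → Aut n → Set
InImage φ G x = ∃ λ g → g ∈ G × φ g ≡ φ x

InImage? : ∀ {n} {B : Set} → DecidableEquality B → (φ : Aut n → B) (G : Subset n) → Decidable (InImage φ G)
InImage? _≟ᴮ_ φ G x = Aut-∃? (λ g → (G g Bool.≟ true) ×-dec (φ g ≟ᴮ φ x))

injectiveOn-transfer : ∀ {n} {B : Set} {φ : Aut n → B} {H G : Subset n} → SameOrder H G →
  InjectiveOn φ H → (∀ h → h ∈ H → InImage φ G h) → InjectiveOn φ G
injectiveOn-transfer {n} {φ = φ} {H} {G} H↔G φ-injOn-H H⊆φ⁻¹φG g₁ g₂ g₁∈G g₂∈G φg₁≡φg₂ = begin
  g₁               ≡⟨ cong proj₁ (sym (proj₂ (lift-surjective (g₁ , g₁∈G)))) ⟩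
  proj₁ (lift h₁)  ≡⟨ cong (proj₁ ∘ lift) h₁≡h₂ ⟩
  proj₁ (lift h₂)  ≡⟨ cong proj₁ (proj₂ (lift-surjective (g₂ , g₂∈G))) ⟩
  g₂               ∎
  where
  open ≡-Reasoning
  lift : El H → El G
  lift (h , h∈H) = proj₁ (H⊆φ⁻¹φG h h∈H) , proj₁ (proj₂ (H⊆φ⁻¹φG h h∈H))

  φ∘lift : ∀ h → φ (proj₁ (lift h)) ≡ φ (proj₁ h)
  φ∘lift (h , h∈H) = proj₂ (proj₂ (H⊆φ⁻¹φG h h∈H))

  lift-reflects-φ : ∀ h h′ → φ (proj₁ (lift h)) ≡ φ (proj₁ (lift h′)) → h ≡ h′
  lift-reflects-φ (h , h∈H) (h′ , h′∈H) eq = subtype-≡ H h∈H h′∈H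
    (φ-injOn-H h h′ h∈H h′∈H (trans (sym (φ∘lift (h , h∈H))) (trans eq (φ∘lift (h′ , h′∈H)))))

  lift-surjective : ∀ g → ∃ λ h → lift h ≡ g
  lift-surjective = injective⇒surjective H↔G (subtype-dedekindFinite H (Aut-dedekindFinite n)) lift
    (λ h h′ eq → lift-reflects-φ h h′ (cong (φ ∘ proj₁) eq))

  h₁ h₂ : El H
  h₁ = proj₁ (lift-surjective (g₁ , g₁∈G))
  h₂ = proj₁ (lift-surjective (g₂ , g₂∈G))

  h₁≡h₂ : h₁ ≡ h₂
  h₁≡h₂ = lift-reflects-φ h₁ h₂ (begin
    φ (proj₁ (lift h₁)) ≡⟨ cong (φ ∘ proj₁) (proj₂ (lift-surjective (g₁ , g₁∈G))) ⟩
    φ g₁                ≡⟨ φg₁≡φg₂ ⟩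
    φ g₂                ≡⟨ cong (φ ∘ proj₁) (sym (proj₂ (lift-surjective (g₂ , g₂∈G)))) ⟩
    φ (proj₁ (lift h₂)) ∎)

does⇒ : ∀ {A : Set} (a? : Dec A) → does a? ≡ true → A
does⇒ (yes a) _ = a

-- π⁻¹(π G), that is, the product G K_n.
saturate : ∀ n → Subset (suc n) → Subset (suc n)
saturate n G x = does (InImage? _≟ᴬ_ (restrict n) G x)

∈-saturate⁺ : ∀ n (G : Subset (suc n)) {x} → InImage (restrict n) G x → x ∈ saturate n G
∈-saturate⁺ n G {x} = Dec.dec-true (InImage? _≟ᴬ_ (restrict n) G x)

∈-saturate⁻ : ∀ n (G : Subset (suc n)) {x} → x ∈ saturate n G → InImage (restrict n) G x
∈-saturate⁻ n G {x} = does⇒ (InImage? _≟ᴬ_ (restrict n) G x)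

saturate-isSubgroup : ∀ n {G : Subset (suc n)} → IsSubgroup G → IsSubgroup (saturate n G)
saturate-isSubgroup n {G} G≤ = record
  { has-e  = ∈-saturate⁺ n G (e , has-e , refl)
  ; has-·  = λ x y x∈ y∈ → ∈-saturate⁺ n G (·-closed (∈-saturate⁻ n G x∈) (∈-saturate⁻ n G y∈))
  ; has-⁻¹ = λ x x∈ → ∈-saturate⁺ n G (⁻¹-closed (∈-saturate⁻ n G x∈))
  }
  where
  open IsSubgroup G≤
  π : Aut (suc n) → Aut n
  π = restrict n
  ·-closed : ∀ {x y} → InImage π G x → InImage π G y → InImage π G (x · y)
  ·-closed {x} {y} (g , g∈G , πg≡πx) (g′ , g′∈G , πg′≡πy) = g · g′ , has-· g g′ g∈G g′∈G ,
    trans (restrict-· n g g′) (trans (cong₂ _·_ πg≡πx πg′≡πy) (sym (restrict-· n x y)))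
  ⁻¹-closed : ∀ {x} → InImage π G x → InImage π G (x ⁻¹)
  ⁻¹-closed {x} (g , g∈G , πg≡πx) = g ⁻¹ , has-⁻¹ g g∈G ,
    trans (restrict-⁻¹ n g) (trans (cong _⁻¹ πg≡πx) (sym (restrict-⁻¹ n x)))

lemma4p5 : (m : ℕ) (H G : Subset (suc m)) →
    IsSubgroup H → IsSubgroup G → ¬ IsCyclic H → ¬ IsCyclic G →
    (∀ x → x ∈ H → InK m x → x ≡ e) →
    SameOrder H G →
    (∀ h → h ∈ H → Σ (Aut (suc m)) (λ c → InK m c × conj h c ∈ G)) →
    (H₁ H₂ : Subset (suc m)) → IsMaximal H₁ H → IsMaximal H₂ H → ¬ (H₁ ≐ H₂) →
    (a : Aut (suc m)) → InK m a → IsGeneratedBy G (H₁ ∪ (H₂ ^ˢ a)) →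
    InK m a × (∀ x → InFrattini H x → a · x ≡ x · a)
lemma4p5 m H G H≤ G≤ _ _ H∩K≡e |H|≡|G| _ H₁ H₂ H₁-max H₂-max H₁≉H₂ a a∈K G≡⟨H₁,H₂ᵃ⟩ =
  a∈K , λ x x∈Φ → conj-fixed⇒commute x a
    (π-injOn-G (conj x a) x (H₂ᵃ⊆G x (x∈Φ H₂ H₂-max)) (H₁⊆G x (x∈Φ H₁ H₁-max)) (restrict-conj m x a∈K))
  where
  H₁⊆G : H₁ ⊆ G
  H₁⊆G h h∈H₁ = proj₂ (G≡⟨H₁,H₂ᵃ⟩ h) (gen (inj₁ h∈H₁))

  H₂ᵃ⊆G : ∀ h → h ∈ H₂ → conj h a ∈ G
  H₂ᵃ⊆G h h∈H₂ = proj₂ (G≡⟨H₁,H₂ᵃ⟩ _) (gen (inj₂ (subst (_∈ H₂) (sym (conj-cancel h a)) h∈H₂)))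

  H⊆GK : H ⊆ saturate m G
  H⊆GK = distinct-maximal-⊆ H≤ H₁-max H₂-max H₁≉H₂ (saturate-isSubgroup m G≤)
    (λ h h∈H₁ → ∈-saturate⁺ m G (h , H₁⊆G h h∈H₁ , refl))
    (λ h h∈H₂ → ∈-saturate⁺ m G (conj h a , H₂ᵃ⊆G h h∈H₂ , restrict-conj m h a∈K))

  π-injOn-G : InjectiveOn (restrict m) G
  π-injOn-G = injectiveOn-transfer |H|≡|G| (trivial-kernel⇒injectiveOn m H≤ H∩K≡e)
    (λ h h∈H → ∈-saturate⁻ m G (H⊆GK h h∈H))
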